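{- Let $\rho$ be an excluded minor of rank $4$ for the class $\mathcal{P}_{U_{2,4}}$ of $2$-polymatroids whose natural matroids are binary. If $\rho$ consists of three lines, then $\rho$ is isomorphic to $A_4$. If $\rho$ consists of two lines and two points, with no point lying on a line, then $\rho$ is isomorphic to $B_4$.
   Context: A (integer) polymatroid is $(E,\rho)$ with $E$ finite, $\rho:2^E\to\mathbb{Z}$ normalized, nondecreasing and submodular; a $2$-polymatroid has $\rho(\{e\})\le 2$ for all $e$; points and lines are elements of rank $1$ and $2$; a point $p$ lies on a line $\ell$ if $\rho(\{p,\ell\})=2$. Deletion $\rho_{\setminus X}$ is restriction; contraction $\rho_{/X}(Y)=\rho(Y\cup X)-\rho(X)$; minors are $(\rho_{\setminus X})_{/Y}$; an excluded minor is not in the class but all its proper minors are. Natural matroid $M_\rho$: pairwise disjoint sets $X_e$ with $|X_e|=\rho(\{e\})$, $X_A=\bigcup_{e\in A}X_e$, rank $r(X)=\min\{\rho(A)+|X-X_A|:A\subseteq E\}$ on $X_E$. $A_4$: three lines $a,b,c$ with $\rho(\{a,b\})=\rho(\{a,c\})=3$ and $\rho(\{b,c\})=\rho(\{a,b,c\})=4$. $B_4$: elements $a_1,a_2$ (points) and $b,c$ (lines) with $\rho(\{a_1,a_2\})=2$, $\rho(\{a_i,b\})=\rho(\{a_i,c\})=3$, $\rho(\{a_1,a_2,b\})=\rho(\{a_1,a_2,c\})=3$, and $\rho(X)=4$ for every $X\supseteq\{b,c\}$. -}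

module Defs where

open import Data.Nat using (ℕ; zero; suc; _+_; _∸_; _≤_)
open import Data.Bool using (Bool; true; false; _xor_)
open import Data.Fin using (Fin; zero; suc)
open import Data.Fin.Subset using (Subset; _∈_; _∉_; _⊆_; _∪_; _∩_; ∁; ⁅_⁆; ⊥; ⊤; ∣_∣; Nonempty)
open import Data.Vec using (Vec; []; _∷_; replicate; zipWith; lookup; tabulate)
open import Data.Product using (Σ; ∃; _×_; _,_)
open import Relation.Nullary using (¬_)
open import Relation.Binary.PropositionalEquality using (_≡_; _≢_)
open import Function.Bundles using (_↔_; Inverse)

-- A "polymatroid on ground set S ⊆ Fin n" is given by a function
-- ρ : Subset n → ℕ, of which only the values on subsets of S matter.
-- (Ranks take values in ℕ; for a normalized nondecreasing function,
-- values are automatically nonnegative, so this loses nothing.)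

SetFn : ℕ → Set
SetFn n = Subset n → ℕ

record Is2Polymatroid {n : ℕ} (S : Subset n) (ρ : SetFn n) : Set where
  field
    normalized    : ρ ⊥ ≡ 0
    nondecreasing : ∀ X Y → Y ⊆ S → X ⊆ Y → ρ X ≤ ρ Y
    submodular    : ∀ X Y → X ⊆ S → Y ⊆ S → ρ (X ∪ Y) + ρ (X ∩ Y) ≤ ρ X + ρ Y
    two           : ∀ e → e ∈ S → ρ ⁅ e ⁆ ≤ 2

-- Each e ∈ S gets the set X_e = {(e,i) : i < ρ({e})} with i ∈ {0,1}
-- (ρ({e}) ≤ 2).  A subset of X_E is encoded as a pair (X₀ , X₁) of
-- subsets of Fin n: e ∈ Xᵢ means (e,i) is in the set.

NSet : ℕ → Set
NSet n = Subset n × Subset n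

level : {n : ℕ} → Subset n → SetFn n → ℕ → Subset n
level S ρ j = tabulate (λ e → lev (lookup S e) e)
  where
  lev : Bool → Fin _ → Bool
  lev false e = false
  lev true  e = Data.Nat._≤ᵇ_ j (ρ ⁅ e ⁆)
    where import Data.Nat

InGround : {n : ℕ} → Subset n → SetFn n → NSet n → Set
InGround S ρ (X₀ , X₁) = (X₀ ⊆ level S ρ 1) × (X₁ ⊆ level S ρ 2)

XA : {n : ℕ} → Subset n → SetFn n → Subset n → NSet n
XA S ρ A = (A ∩ level S ρ 1 , A ∩ level S ρ 2)

ncard : {n : ℕ} → NSet n → ℕ
ncard (X₀ , X₁) = ∣ X₀ ∣ + ∣ X₁ ∣

nminus : {n : ℕ} → NSet n → NSet n → NSet n
nminus (X₀ , X₁) (Y₀ , Y₁) = (X₀ ∩ ∁ Y₀ , X₁ ∩ ∁ Y₁)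

natVal : {n : ℕ} → Subset n → SetFn n → NSet n → Subset n → ℕ
natVal S ρ X A = ρ A + ncard (nminus X (XA S ρ A))

NatRankIs : {n : ℕ} → Subset n → SetFn n → NSet n → ℕ → Set
NatRankIs S ρ X k =
  (∃ λ A → A ⊆ S × natVal S ρ X A ≡ k) × (∀ A → A ⊆ S → k ≤ natVal S ρ X A)

NatIndep : {n : ℕ} → Subset n → SetFn n → NSet n → Set
NatIndep S ρ X = NatRankIs S ρ X (ncard X)

_⊕_ : {k : ℕ} → Vec Bool k → Vec Bool k → Vec Bool k
_⊕_ = zipWith _xor_

zeroV : {k : ℕ} → Vec Bool k
zeroV = replicate _ false

sumSub : {k n : ℕ} → (Fin n → Vec Bool k) → Subset n → Vec Bool k
sumSub {n = zero}  f []          = zeroV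
sumSub {n = suc n} f (true  ∷ Z) = f zero ⊕ sumSub (λ i → f (suc i)) Z
sumSub {n = suc n} f (false ∷ Z) = sumSub (λ i → f (suc i)) Z

-- an assignment of vectors in GF(2)^k to the elements (e,i) of X_E
Vectors : ℕ → ℕ → Set
Vectors k n = Fin 2 → Fin n → Vec Bool k

nsum : {k n : ℕ} → Vectors k n → NSet n → Vec Bool k
nsum v (Z₀ , Z₁) = sumSub (v zero) Z₀ ⊕ sumSub (v (suc zero)) Z₁

_⊆ₙ_ : {n : ℕ} → NSet n → NSet n → Set
(Z₀ , Z₁) ⊆ₙ (X₀ , X₁) = (Z₀ ⊆ X₀) × (Z₁ ⊆ X₁)

NNonempty : {n : ℕ} → NSet n → Set
NNonempty (Z₀ , Z₁) = Nonempty Z₀ Data.Sum.⊎ Nonempty Z₁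
  where import Data.Sum

GF2Indep : {k n : ℕ} → Vectors k n → NSet n → Set
GF2Indep v X = ∀ Z → Z ⊆ₙ X → NNonempty Z → nsum v Z ≢ zeroV

NaturalMatroidBinary : {n : ℕ} → Subset n → SetFn n → Set
NaturalMatroidBinary {n} S ρ =
  Σ ℕ λ k → Σ (Vectors k n) λ v →
    ∀ X → InGround S ρ X →
      (NatIndep S ρ X → GF2Indep v X) × (GF2Indep v X → NatIndep S ρ X)

InClass : {n : ℕ} → Subset n → SetFn n → Set
InClass S ρ = Is2Polymatroid S ρ × NaturalMatroidBinary S ρ

-- Minors.  Deleting X and contracting Y (X, Y disjoint) gives the
-- polymatroid on ground set E - (X ∪ Y) with rank Z ↦ ρ(Z ∪ Y) - ρ(Y).

contract : {n : ℕ} → Subset n → SetFn n → SetFn n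
contract Y ρ Z = ρ (Z ∪ Y) ∸ ρ Y

Disjoint : {n : ℕ} → Subset n → Subset n → Set
Disjoint X Y = ∀ e → e ∈ X → e ∉ Y

ExcludedMinor : {n : ℕ} → SetFn n → Set
ExcludedMinor ρ =
  Is2Polymatroid ⊤ ρ × ¬ InClass ⊤ ρ ×
  (∀ X Y → Disjoint X Y → Nonempty (X ∪ Y) →
     InClass (∁ (X ∪ Y)) (contract Y ρ))

image : {n m : ℕ} → Fin n ↔ Fin m → Subset n → Subset m
image f Y = tabulate (λ i → lookup Y (Inverse.from f i))

Isomorphic : {n m : ℕ} → SetFn n → SetFn m → Set
Isomorphic {n} {m} ρ σ = Σ (Fin n ↔ Fin m) λ f → ∀ Y → ρ Y ≡ σ (image f Y)

-- A₄ : lines a = 0, b = 1, c = 2.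
A₄ : SetFn 3
A₄ (false ∷ false ∷ false ∷ []) = 0
A₄ (true  ∷ false ∷ false ∷ []) = 2
A₄ (false ∷ true  ∷ false ∷ []) = 2
A₄ (false ∷ false ∷ true  ∷ []) = 2
A₄ (true  ∷ true  ∷ false ∷ []) = 3
A₄ (true  ∷ false ∷ true  ∷ []) = 3
A₄ (false ∷ true  ∷ true  ∷ []) = 4
A₄ (true  ∷ true  ∷ true  ∷ []) = 4

-- B₄ : points a₁ = 0, a₂ = 1, lines b = 2, c = 3.
B₄ : SetFn 4
B₄ (false ∷ false ∷ false ∷ false ∷ []) = 0
B₄ (true  ∷ false ∷ false ∷ false ∷ []) = 1
B₄ (false ∷ true  ∷ false ∷ false ∷ []) = 1
B₄ (false ∷ false ∷ true  ∷ false ∷ []) = 2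
B₄ (false ∷ false ∷ false ∷ true  ∷ []) = 2
B₄ (true  ∷ true  ∷ false ∷ false ∷ []) = 2
B₄ (true  ∷ false ∷ true  ∷ false ∷ []) = 3
B₄ (false ∷ true  ∷ true  ∷ false ∷ []) = 3
B₄ (true  ∷ false ∷ false ∷ true  ∷ []) = 3
B₄ (false ∷ true  ∷ false ∷ true  ∷ []) = 3
B₄ (false ∷ false ∷ true  ∷ true  ∷ []) = 4
B₄ (true  ∷ true  ∷ true  ∷ false ∷ []) = 3
B₄ (true  ∷ true  ∷ false ∷ true  ∷ []) = 3
B₄ (true  ∷ false ∷ true  ∷ true  ∷ []) = 4
B₄ (false ∷ true  ∷ true  ∷ true  ∷ []) = 4
B₄ (true  ∷ true  ∷ true  ∷ true  ∷ []) = 4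

IsPoint IsLine : {n : ℕ} → SetFn n → Fin n → Set
IsPoint ρ e = ρ ⁅ e ⁆ ≡ 1
IsLine  ρ e = ρ ⁅ e ⁆ ≡ 2

LiesOn : {n : ℕ} → SetFn n → Fin n → Fin n → Set
LiesOn ρ p ℓ = ρ (⁅ p ⁆ ∪ ⁅ ℓ ⁆) ≡ 2

ThreeLines : {n : ℕ} → SetFn n → Set
ThreeLines {n} ρ = (n ≡ 3) × (∀ e → IsLine ρ e)

TwoLinesTwoPoints : {n : ℕ} → SetFn n → Set
TwoLinesTwoPoints {n} ρ =
  Σ (Fin n) λ p₁ → Σ (Fin n) λ p₂ → Σ (Fin n) λ ℓ₁ → Σ (Fin n) λ ℓ₂ →
    (p₁ ≢ p₂) × (ℓ₁ ≢ ℓ₂) ×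
    IsPoint ρ p₁ × IsPoint ρ p₂ × IsLine ρ ℓ₁ × IsLine ρ ℓ₂ ×
    (∀ e → (e ≡ p₁) Data.Sum.⊎ (e ≡ p₂) Data.Sum.⊎ (e ≡ ℓ₁) Data.Sum.⊎ (e ≡ ℓ₂))
  where import Data.Sum

-- Both shapes leave only the ranks of a few sets undetermined: the singletons
-- and the whole ground set are given, and monotonicity and submodularity
-- confine the remaining ranks to short intervals (with two points and two
-- lines and no incidences, every point together with a line has rank 3).
-- Each of the resulting finitely many candidate rank functions is disposed of
-- by a certificate checked by evaluation: the candidate is not submodular; or
-- an explicit GF(2) representation puts it in the class; or a proper minor has
-- two circuits with independent symmetric difference, impossible in a binary
-- matroid since over GF(2) every circuit sums to zero; or it is isomorphic to
-- A₄, respectively B₄.  Two points and two lines are first moved into a fixed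
-- position, which is harmless because being an excluded minor is invariant
-- under isomorphism.
module Submission where

open import Defs
open import Algebra.Bundles using (CommutativeMonoid)
import Algebra.Properties.CommutativeMonoid.Sum as MonoidSum
open import Algebra.Properties.CommutativeSemigroup using (interchange)
open import Data.Bool using (Bool; true; false; not; _∧_; _xor_; if_then_else_)
import Data.Bool.Properties as Bool
open import Data.Bool.Properties using (xor-assoc; xor-comm; xor-identityˡ; xor-identityʳ; xor-same)
open import Data.Empty using (⊥-elim)
open import Data.Fin using (Fin; zero; suc; toℕ; fromℕ<)
open import Data.Fin.Permutation using (flip; transpose; ↔⇒≡)
open import Data.Fin.Properties using (all?; toℕ-fromℕ<)
open import Data.Fin.Subset using (Subset; _∈_; _⊆_; _∪_; _∩_; ∁; ⁅_⁆; ⊥; ⊤; ∣_∣; Nonempty)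
open import Data.Fin.Subset.Properties
  using (⊆-antisym; ⊆-max; x∈⁅x⁆; x∈⁅y⁆⇒x≡y; p⊆p∪q; q⊆p∪q; _⊆?_; _∈?_; nonempty?; anySubset?)
open import Data.Nat using (ℕ; zero; suc; _+_; _∸_; _≤_; _≤ᵇ_; _≤?_; s≤s)
open import Data.Nat.Properties using (_≟_; +-0-commutativeMonoid; m+n≤o⇒m≤o)
open import Data.Product using (Σ; _×_; _,_; proj₁; proj₂)
import Data.Product.Properties as Product
open import Data.Sum using (inj₁; inj₂)
open import Data.Unit using (tt)
open import Data.Vec using (Vec; []; _∷_; replicate; zipWith; lookup)
import Data.Vec.Properties as Vec
open import Data.Vec.Properties
  using (lookup∘tabulate; tabulate∘lookup; tabulate-cong; lookup-zipWith; lookup-map; lookup-replicate;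
         []=⇒lookup; lookup⇒[]=; zipWith-assoc; zipWith-comm; zipWith-identityˡ; zipWith-identityʳ)
open import Function using (_∘_)
open import Function.Bundles using (_↔_; Inverse; mk⤖)
open import Function.Properties.Bijection using (⤖⇒↔)
open import Function.Properties.Inverse using (↔-sym; ↔-trans; ↔-refl)
open import Level using (0ℓ)
open import Relation.Binary.Definitions using (DecidableEquality)
open import Relation.Binary.PropositionalEquality
  using (_≡_; _≢_; refl; sym; trans; cong; cong₂; subst; subst₂; isEquivalence; module ≡-Reasoning)
open import Relation.Nullary using (¬_; Dec; yes; no; contradiction)
open import Relation.Nullary.Decidable using (True; toWitness; _×-dec_; _→-dec_; _⊎-dec_; ¬?; map′)

open Inverse using (to; from)

private
  variable
    n m k t : ℕ

lookup-ext : {A : Set} {xs ys : Vec A n} → (∀ i → lookup xs i ≡ lookup ys i) → xs ≡ ys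
lookup-ext {xs = xs} {ys} eq =
  trans (sym (tabulate∘lookup xs)) (trans (tabulate-cong eq) (tabulate∘lookup ys))

lookup-image : (f : Fin n ↔ Fin m) (Y : Subset n) (i : Fin m) → lookup (image f Y) i ≡ lookup Y (from f i)
lookup-image f Y = lookup∘tabulate (lookup Y ∘ from f)

image-zipWith : (f : Fin n ↔ Fin m) (h : Bool → Bool → Bool) (X Y : Subset n) →
  image f (zipWith h X Y) ≡ zipWith h (image f X) (image f Y)
image-zipWith f h X Y = lookup-ext λ i → begin
  lookup (image f (zipWith h X Y)) i              ≡⟨ lookup-image f (zipWith h X Y) i ⟩
  lookup (zipWith h X Y) (from f i)               ≡⟨ lookup-zipWith h (from f i) X Y ⟩
  h (lookup X (from f i)) (lookup Y (from f i))   ≡⟨ sym (cong₂ h (lookup-image f X i) (lookup-image f Y i)) ⟩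
  h (lookup (image f X) i) (lookup (image f Y) i) ≡⟨ sym (lookup-zipWith h i (image f X) (image f Y)) ⟩
  lookup (zipWith h (image f X) (image f Y)) i    ∎
  where open ≡-Reasoning

image-∪ : (f : Fin n ↔ Fin m) (X Y : Subset n) → image f (X ∪ Y) ≡ image f X ∪ image f Y
image-∪ f = image-zipWith f _

image-∩ : (f : Fin n ↔ Fin m) (X Y : Subset n) → image f (X ∩ Y) ≡ image f X ∩ image f Y
image-∩ f = image-zipWith f _

image-∁ : (f : Fin n ↔ Fin m) (X : Subset n) → image f (∁ X) ≡ ∁ (image f X)
image-∁ f X = lookup-ext λ i →
  trans (lookup-image f (∁ X) i)
 (trans (lookup-map (from f i) not X)
 (trans (cong not (sym (lookup-image f X i))) (sym (lookup-map i not (image f X)))))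

image-replicate : (f : Fin n ↔ Fin m) (b : Bool) → image f (replicate n b) ≡ replicate m b
image-replicate f b = lookup-ext λ i →
  trans (lookup-image f (replicate _ b) i) (trans (lookup-replicate (from f i) b) (sym (lookup-replicate i b)))

image-inverse : (f : Fin n ↔ Fin m) (Y : Subset n) → image (↔-sym f) (image f Y) ≡ Y
image-inverse f Y = lookup-ext λ e →
  trans (lookup-image (↔-sym f) (image f Y) e)
 (trans (lookup-image f Y (to f e)) (cong (lookup Y) (Inverse.strictlyInverseʳ f e)))

image-inverse′ : (f : Fin n ↔ Fin m) (Y : Subset m) → image f (image (↔-sym f) Y) ≡ Y
image-inverse′ f Y = lookup-ext λ i →
  trans (lookup-image f (image (↔-sym f) Y) i)
 (trans (lookup-image (↔-sym f) Y (from f i)) (cong (lookup Y) (Inverse.strictlyInverseˡ f i)))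

image-↔-refl : (Y : Subset n) → image ↔-refl Y ≡ Y
image-↔-refl Y = lookup-ext (lookup-image ↔-refl Y)

image-↔-trans : (f : Fin n ↔ Fin m) (g : Fin m ↔ Fin k) (Y : Subset n) →
  image (↔-trans f g) Y ≡ image g (image f Y)
image-↔-trans f g Y = lookup-ext λ i →
  trans (lookup-image (↔-trans f g) Y i)
 (sym (trans (lookup-image g (image f Y) i) (lookup-image f Y (from g i))))

∈-image⁺ : (f : Fin n ↔ Fin m) {Y : Subset n} {i : Fin m} → from f i ∈ Y → i ∈ image f Y
∈-image⁺ f {Y} {i} i∈ = lookup⇒[]= i (image f Y) (trans (lookup-image f Y i) ([]=⇒lookup i∈))

∈-image⁻ : (f : Fin n ↔ Fin m) {Y : Subset n} {i : Fin m} → i ∈ image f Y → from f i ∈ Y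
∈-image⁻ f {Y} {i} i∈ = lookup⇒[]= (from f i) Y (trans (sym (lookup-image f Y i)) ([]=⇒lookup i∈))

image-⊆ : (f : Fin n ↔ Fin m) {X Y : Subset n} → X ⊆ Y → image f X ⊆ image f Y
image-⊆ f X⊆Y = ∈-image⁺ f ∘ X⊆Y ∘ ∈-image⁻ f

image-nonempty : (f : Fin n ↔ Fin m) {Y : Subset n} → Nonempty Y → Nonempty (image f Y)
image-nonempty f {Y} (e , e∈Y) =
  to f e , ∈-image⁺ f (subst (_∈ Y) (sym (Inverse.strictlyInverseʳ f e)) e∈Y)

image-⁅⁆ : (f : Fin n ↔ Fin m) (e : Fin n) → image f ⁅ e ⁆ ≡ ⁅ to f e ⁆
image-⁅⁆ f e = ⊆-antisym
  (λ i∈ → subst (_∈ ⁅ to f e ⁆) (to-from (x∈⁅y⁆⇒x≡y e (∈-image⁻ f i∈))) (x∈⁅x⁆ (to f e)))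
  (λ i∈ → ∈-image⁺ f (subst (_∈ ⁅ e ⁆) (sym (from-to (x∈⁅y⁆⇒x≡y (to f e) i∈))) (x∈⁅x⁆ e)))
  where
  to-from : ∀ {i} → from f i ≡ e → to f e ≡ i
  to-from {i} eq = trans (cong (to f) (sym eq)) (Inverse.strictlyInverseˡ f i)
  from-to : ∀ {i} → i ≡ to f e → from f i ≡ e
  from-to refl = Inverse.strictlyInverseʳ f e

image-⊆⁻ : (f : Fin n ↔ Fin m) {X Y : Subset n} → image f X ⊆ image f Y → X ⊆ Y
image-⊆⁻ f {X} {Y} fX⊆fY = subst₂ _⊆_ (image-inverse f X) (image-inverse f Y) (image-⊆ (↔-sym f) fX⊆fY)

⊆-image⁻¹ : (f : Fin n ↔ Fin m) {B : Subset m} {S : Subset n} → B ⊆ image f S → image (↔-sym f) B ⊆ S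
⊆-image⁻¹ f {S = S} B⊆fS = subst (_ ⊆_) (image-inverse f S) (image-⊆ (↔-sym f) B⊆fS)

module SubsetSum {c ℓ} (M : CommutativeMonoid c ℓ) where
  open CommutativeMonoid M using (Carrier; _≈_; ε; reflexive) renaming (trans to ≈-trans; sym to ≈-sym)
  open MonoidSum M using (sum; sum-cong-≗; sum-permute)

  ∑∈ : (Fin n → Carrier) → Subset n → Carrier
  ∑∈ t Z = sum (λ i → if lookup Z i then t i else ε)

  ∑∈-image : (f : Fin n ↔ Fin m) (t : Fin n → Carrier) (Z : Subset n) →
    ∑∈ (t ∘ from f) (image f Z) ≈ ∑∈ t Z
  ∑∈-image f t Z = ≈-trans
    (reflexive (sum-cong-≗ λ i → cong (λ b → if b then t (from f i) else ε) (lookup-image f Z i)))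
    (≈-sym (sum-permute (λ e → if lookup Z e then t e else ε) (flip f)))

module CardinalitySum = SubsetSum +-0-commutativeMonoid

∣∣≡∑∈ : (Z : Subset n) → ∣ Z ∣ ≡ CardinalitySum.∑∈ (λ _ → 1) Z
∣∣≡∑∈ [] = refl
∣∣≡∑∈ (true ∷ Z) = cong suc (∣∣≡∑∈ Z)
∣∣≡∑∈ (false ∷ Z) = ∣∣≡∑∈ Z

∣image∣ : (f : Fin n ↔ Fin m) (Z : Subset n) → ∣ image f Z ∣ ≡ ∣ Z ∣
∣image∣ f Z = trans (∣∣≡∑∈ (image f Z)) (trans (CardinalitySum.∑∈-image f (λ _ → 1) Z) (sym (∣∣≡∑∈ Z)))

⊕-commutativeMonoid : ℕ → CommutativeMonoid 0ℓ 0ℓ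
⊕-commutativeMonoid k = record
  { Carrier = Vec Bool k
  ; _≈_ = _≡_
  ; _∙_ = _⊕_
  ; ε = zeroV
  ; isCommutativeMonoid = record
    { isMonoid = record
      { isSemigroup = record
        { isMagma = record { isEquivalence = isEquivalence ; ∙-cong = cong₂ _⊕_ }
        ; assoc = zipWith-assoc xor-assoc }
      ; identity = zipWith-identityˡ xor-identityˡ , zipWith-identityʳ xor-identityʳ }
    ; comm = zipWith-comm xor-comm }
  }

module GF2Sum (k : ℕ) = SubsetSum (⊕-commutativeMonoid k)

sumSub≡∑∈ : (t : Fin n → Vec Bool k) (Z : Subset n) → sumSub t Z ≡ GF2Sum.∑∈ k t Z
sumSub≡∑∈ t [] = refl
sumSub≡∑∈ t (true ∷ Z) = cong (t zero ⊕_) (sumSub≡∑∈ (t ∘ suc) Z)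
sumSub≡∑∈ t (false ∷ Z) = trans (sumSub≡∑∈ (t ∘ suc) Z) (sym (zipWith-identityˡ xor-identityˡ _))

sumSub-image : (f : Fin n ↔ Fin m) (t : Fin n → Vec Bool k) (Z : Subset n) →
  sumSub (t ∘ from f) (image f Z) ≡ sumSub t Z
sumSub-image {k = k} f t Z =
  trans (sumSub≡∑∈ (t ∘ from f) (image f Z)) (trans (GF2Sum.∑∈-image k f t Z) (sym (sumSub≡∑∈ t Z)))

⊕-self : (x : Vec Bool k) → x ⊕ x ≡ zeroV
⊕-self [] = refl
⊕-self (b ∷ x) = cong₂ _∷_ (xor-same b) (⊕-self x)

sumSub-xor : (t : Fin n → Vec Bool k) (Z W : Subset n) →
  sumSub t (zipWith _xor_ Z W) ≡ sumSub t Z ⊕ sumSub t W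
sumSub-xor {k = k} t Z W = begin
  sumSub t (zipWith _xor_ Z W)                        ≡⟨ sumSub≡∑∈ t _ ⟩
  sum (λ i → select (lookup (zipWith _xor_ Z W) i) i) ≡⟨ sum-cong-≗ (λ i → cong (λ b → select b i) (lookup-zipWith _xor_ i Z W)) ⟩
  sum (λ i → select (lookup Z i xor lookup W i) i)    ≡⟨ sum-cong-≗ (λ i → select-xor (lookup Z i) (lookup W i) i) ⟩
  sum (λ i → select (lookup Z i) i ⊕ select (lookup W i) i) ≡⟨ ∑-distrib-+ (λ i → select (lookup Z i) i) (λ i → select (lookup W i) i) ⟩
  GF2Sum.∑∈ k t Z ⊕ GF2Sum.∑∈ k t W                   ≡⟨ sym (cong₂ _⊕_ (sumSub≡∑∈ t Z) (sumSub≡∑∈ t W)) ⟩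
  sumSub t Z ⊕ sumSub t W                             ∎
  where
  open ≡-Reasoning
  open MonoidSum (⊕-commutativeMonoid k) using (sum; sum-cong-≗; ∑-distrib-+)
  select : Bool → Fin _ → Vec Bool k
  select b i = if b then t i else zeroV
  select-xor : ∀ a b i → select (a xor b) i ≡ select a i ⊕ select b i
  select-xor false false i = sym (zipWith-identityˡ xor-identityˡ zeroV)
  select-xor false true  i = sym (zipWith-identityˡ xor-identityˡ (t i))
  select-xor true  false i = sym (zipWith-identityʳ xor-identityʳ (t i))
  select-xor true  true  i = sym (⊕-self (t i))

-- Excluded minors are invariant under isomorphism

-- `level` is defined through a local helper, so its entries compute only
-- once the subset is known at the position in question; hence this fact is
-- established separately for each ground-set size that occurs.
LookupLevel : ℕ → Set
LookupLevel n = (S : Subset n) (ρ : SetFn n) (j : ℕ) (e : Fin n) →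
  lookup (level S ρ j) e ≡ lookup S e ∧ (j ≤ᵇ ρ ⁅ e ⁆)

lookup-level₃ : LookupLevel 3
lookup-level₃ (true  ∷ _ ∷ _ ∷ []) ρ j zero = refl
lookup-level₃ (false ∷ _ ∷ _ ∷ []) ρ j zero = refl
lookup-level₃ (_ ∷ true  ∷ _ ∷ []) ρ j (suc zero) = refl
lookup-level₃ (_ ∷ false ∷ _ ∷ []) ρ j (suc zero) = refl
lookup-level₃ (_ ∷ _ ∷ true  ∷ []) ρ j (suc (suc zero)) = refl
lookup-level₃ (_ ∷ _ ∷ false ∷ []) ρ j (suc (suc zero)) = refl

lookup-level₄ : LookupLevel 4
lookup-level₄ (true  ∷ _ ∷ _ ∷ _ ∷ []) ρ j zero = refl
lookup-level₄ (false ∷ _ ∷ _ ∷ _ ∷ []) ρ j zero = refl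
lookup-level₄ (_ ∷ true  ∷ _ ∷ _ ∷ []) ρ j (suc zero) = refl
lookup-level₄ (_ ∷ false ∷ _ ∷ _ ∷ []) ρ j (suc zero) = refl
lookup-level₄ (_ ∷ _ ∷ true  ∷ _ ∷ []) ρ j (suc (suc zero)) = refl
lookup-level₄ (_ ∷ _ ∷ false ∷ _ ∷ []) ρ j (suc (suc zero)) = refl
lookup-level₄ (_ ∷ _ ∷ _ ∷ true  ∷ []) ρ j (suc (suc (suc zero))) = refl
lookup-level₄ (_ ∷ _ ∷ _ ∷ false ∷ []) ρ j (suc (suc (suc zero))) = refl

imageₙ : Fin n ↔ Fin m → NSet n → NSet m
imageₙ f (X₀ , X₁) = image f X₀ , image f X₁

module _ (f : Fin n ↔ Fin m) where

  imageₙ-inverse : (X : NSet n) → imageₙ (↔-sym f) (imageₙ f X) ≡ X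
  imageₙ-inverse (X₀ , X₁) = cong₂ _,_ (image-inverse f X₀) (image-inverse f X₁)

  imageₙ-inverse′ : (X : NSet m) → imageₙ f (imageₙ (↔-sym f) X) ≡ X
  imageₙ-inverse′ (X₀ , X₁) = cong₂ _,_ (image-inverse′ f X₀) (image-inverse′ f X₁)

  ncard-image : (X : NSet n) → ncard (imageₙ f X) ≡ ncard X
  ncard-image (X₀ , X₁) = cong₂ _+_ (∣image∣ f X₀) (∣image∣ f X₁)

  nminus-image : (X Y : NSet n) → nminus (imageₙ f X) (imageₙ f Y) ≡ imageₙ f (nminus X Y)
  nminus-image (X₀ , X₁) (Y₀ , Y₁) = sym (cong₂ _,_
    (trans (image-∩ f X₀ (∁ Y₀)) (cong (image f X₀ ∩_) (image-∁ f Y₀)))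
    (trans (image-∩ f X₁ (∁ Y₁)) (cong (image f X₁ ∩_) (image-∁ f Y₁))))

  ⊆ₙ-image : {Z X : NSet n} → Z ⊆ₙ X → imageₙ f Z ⊆ₙ imageₙ f X
  ⊆ₙ-image {_ , _} {_ , _} (Z₀⊆X₀ , Z₁⊆X₁) = image-⊆ f Z₀⊆X₀ , image-⊆ f Z₁⊆X₁

  nnonempty-image : {Z : NSet n} → NNonempty Z → NNonempty (imageₙ f Z)
  nnonempty-image {_ , _} (inj₁ ne) = inj₁ (image-nonempty f ne)
  nnonempty-image {_ , _} (inj₂ ne) = inj₂ (image-nonempty f ne)

  nsum-image : (v : Vectors k n) (Z : NSet n) → nsum (λ c → v c ∘ from f) (imageₙ f Z) ≡ nsum v Z
  nsum-image v (Z₀ , Z₁) = cong₂ _⊕_ (sumSub-image f (v zero) Z₀) (sumSub-image f (v (suc zero)) Z₁)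

RankPreserving : Fin n ↔ Fin m → SetFn n → SetFn m → Set
RankPreserving f ρ σ = ∀ Y → ρ Y ≡ σ (image f Y)

rankPreserving-sym : (f : Fin n ↔ Fin m) {ρ : SetFn n} {σ : SetFn m} →
  RankPreserving f ρ σ → RankPreserving (↔-sym f) σ ρ
rankPreserving-sym f {σ = σ} pres Y = sym (trans (pres _) (cong σ (image-inverse′ f Y)))

IndependenceAgrees : Subset n → SetFn n → Vectors k n → NSet n → Set
IndependenceAgrees S ρ v X = (NatIndep S ρ X → GF2Indep v X) × (GF2Indep v X → NatIndep S ρ X)

Represents : Subset n → SetFn n → Vectors k n → Set
Represents S ρ v = ∀ X → InGround S ρ X → IndependenceAgrees S ρ v X

module NaturalMatroidImage
  (lookup-levelⁿ : LookupLevel n) (lookup-levelᵐ : LookupLevel m)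
  (f : Fin n ↔ Fin m) {ρ : SetFn n} {σ : SetFn m} (pres : RankPreserving f ρ σ)
  (S : Subset n) where

  level-image : ∀ j → level (image f S) σ j ≡ image f (level S ρ j)
  level-image j = lookup-ext λ i → begin
    lookup (level (image f S) σ j) i                 ≡⟨ lookup-levelᵐ (image f S) σ j i ⟩
    lookup (image f S) i ∧ (j ≤ᵇ σ ⁅ i ⁆)             ≡⟨ cong₂ (λ b r → b ∧ (j ≤ᵇ r)) (lookup-image f S i) (singleton-rank i) ⟩
    lookup S (from f i) ∧ (j ≤ᵇ ρ ⁅ from f i ⁆)       ≡⟨ sym (lookup-levelⁿ S ρ j (from f i)) ⟩
    lookup (level S ρ j) (from f i)                  ≡⟨ sym (lookup-image f (level S ρ j) i) ⟩
    lookup (image f (level S ρ j)) i                 ∎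
    where
    open ≡-Reasoning
    singleton-rank : ∀ i → σ ⁅ i ⁆ ≡ ρ ⁅ from f i ⁆
    singleton-rank i = sym (trans (pres ⁅ from f i ⁆)
      (cong σ (trans (image-⁅⁆ f (from f i)) (cong ⁅_⁆ (Inverse.strictlyInverseˡ f i)))))

  natVal-image : (X : NSet n) (A : Subset n) →
    natVal (image f S) σ (imageₙ f X) (image f A) ≡ natVal S ρ X A
  natVal-image X A = cong₂ _+_ (sym (pres A)) (begin
    ncard (nminus (imageₙ f X) (XA (image f S) σ (image f A)))  ≡⟨ cong (ncard ∘ nminus (imageₙ f X)) XA-image ⟩
    ncard (nminus (imageₙ f X) (imageₙ f (XA S ρ A)))           ≡⟨ cong ncard (nminus-image f X (XA S ρ A)) ⟩
    ncard (imageₙ f (nminus X (XA S ρ A)))                      ≡⟨ ncard-image f (nminus X (XA S ρ A)) ⟩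
    ncard (nminus X (XA S ρ A))                                 ∎)
    where
    open ≡-Reasoning
    XA-image : XA (image f S) σ (image f A) ≡ imageₙ f (XA S ρ A)
    XA-image = cong₂ _,_
      (trans (cong (image f A ∩_) (level-image 1)) (sym (image-∩ f A (level S ρ 1))))
      (trans (cong (image f A ∩_) (level-image 2)) (sym (image-∩ f A (level S ρ 2))))

  inGround-image⁻ : {X : NSet n} → InGround (image f S) σ (imageₙ f X) → InGround S ρ X
  inGround-image⁻ {_ , _} (X₀⊆ , X₁⊆) =
    image-⊆⁻ f (subst (_ ⊆_) (level-image 1) X₀⊆) , image-⊆⁻ f (subst (_ ⊆_) (level-image 2) X₁⊆)

  natRankIs-image : {X : NSet n} {r : ℕ} → NatRankIs S ρ X r → NatRankIs (image f S) σ (imageₙ f X) r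
  natRankIs-image {X} {r} ((A , A⊆S , val≡r) , minimal) =
    (image f A , image-⊆ f A⊆S , trans (natVal-image X A) val≡r) ,
    λ B B⊆fS → subst (r ≤_)
      (trans (sym (natVal-image X (image (↔-sym f) B))) (cong (natVal (image f S) σ (imageₙ f X)) (image-inverse′ f B)))
      (minimal (image (↔-sym f) B) (⊆-image⁻¹ f B⊆fS))

  natRankIs-image⁻ : {X : NSet n} {r : ℕ} → NatRankIs (image f S) σ (imageₙ f X) r → NatRankIs S ρ X r
  natRankIs-image⁻ {X} {r} ((B , B⊆fS , val≡r) , minimal) =
    (image (↔-sym f) B , ⊆-image⁻¹ f B⊆fS ,
      trans (sym (natVal-image X (image (↔-sym f) B)))
        (trans (cong (natVal (image f S) σ (imageₙ f X)) (image-inverse′ f B)) val≡r)) ,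
    λ A A⊆S → subst (r ≤_) (natVal-image X A) (minimal (image f A) (image-⊆ f A⊆S))

  natIndep-image : {X : NSet n} → NatIndep S ρ X → NatIndep (image f S) σ (imageₙ f X)
  natIndep-image {X} indep = subst (NatRankIs (image f S) σ (imageₙ f X)) (sym (ncard-image f X)) (natRankIs-image {X} indep)

  natIndep-image⁻ : {X : NSet n} → NatIndep (image f S) σ (imageₙ f X) → NatIndep S ρ X
  natIndep-image⁻ {X} indep = natRankIs-image⁻ {X} (subst (NatRankIs (image f S) σ (imageₙ f X)) (ncard-image f X) indep)

module _ (f : Fin n ↔ Fin m) (v : Vectors k n) where

  private
    v′ : Vectors k m
    v′ c = v c ∘ from f

  gf2Indep-image : {X : NSet n} → GF2Indep v X → GF2Indep v′ (imageₙ f X)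
  gf2Indep-image {X} indep Z Z⊆fX nonempty sum≡0 = indep (imageₙ (↔-sym f) Z)
    (subst (_ ⊆ₙ_) (imageₙ-inverse f X) (⊆ₙ-image (↔-sym f) Z⊆fX))
    (nnonempty-image (↔-sym f) nonempty)
    (trans (sym (nsum-image f v (imageₙ (↔-sym f) Z))) (trans (cong (nsum v′) (imageₙ-inverse′ f Z)) sum≡0))

  gf2Indep-image⁻ : {X : NSet n} → GF2Indep v′ (imageₙ f X) → GF2Indep v X
  gf2Indep-image⁻ indep Z Z⊆X nonempty sum≡0 =
    indep (imageₙ f Z) (⊆ₙ-image f Z⊆X) (nnonempty-image f nonempty) (trans (nsum-image f v Z) sum≡0)

module _ (lookup-levelⁿ : LookupLevel n) (lookup-levelᵐ : LookupLevel m)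
  (f : Fin n ↔ Fin m) {ρ : SetFn n} {σ : SetFn m} (pres : RankPreserving f ρ σ) where

  binary-image : {S : Subset n} → NaturalMatroidBinary S ρ → NaturalMatroidBinary (image f S) σ
  binary-image {S} (k , v , represents) = k , v′ , λ X →
    subst (λ X → InGround (image f S) σ X → IndependenceAgrees (image f S) σ v′ X)
      (imageₙ-inverse′ f X) (transfer (imageₙ (↔-sym f) X))
    where
    open NaturalMatroidImage lookup-levelⁿ lookup-levelᵐ f {ρ} {σ} pres S
    v′ : Vectors k m
    v′ c = v c ∘ from f
    transfer : ∀ Y → InGround (image f S) σ (imageₙ f Y) → IndependenceAgrees (image f S) σ v′ (imageₙ f Y)
    transfer Y ground with represents Y (inGround-image⁻ ground)
    ... | indep⇒gf2 , gf2⇒indep =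
      gf2Indep-image f v ∘ indep⇒gf2 ∘ natIndep-image⁻ {Y} ,
      natIndep-image {Y} ∘ gf2⇒indep ∘ gf2Indep-image⁻ f v

module _ (f : Fin n ↔ Fin m) {ρ : SetFn n} {σ : SetFn m} (pres : RankPreserving f ρ σ) where

  is2Polymatroid-image : {S : Subset n} → Is2Polymatroid S ρ → Is2Polymatroid (image f S) σ
  is2Polymatroid-image {S} poly = record
    { normalized = trans (pres⁻ ⊥) (trans (cong ρ (image-replicate (↔-sym f) false)) normalized)
    ; nondecreasing = λ X Y Y⊆fS X⊆Y → subst₂ _≤_ (sym (pres⁻ X)) (sym (pres⁻ Y))
        (nondecreasing _ _ (⊆-image⁻¹ f Y⊆fS) (image-⊆ (↔-sym f) X⊆Y))
    ; submodular = λ X Y X⊆fS Y⊆fS → subst₂ _≤_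
        (sym (cong₂ _+_ (trans (pres⁻ (X ∪ Y)) (cong ρ (image-∪ (↔-sym f) X Y)))
                        (trans (pres⁻ (X ∩ Y)) (cong ρ (image-∩ (↔-sym f) X Y)))))
        (sym (cong₂ _+_ (pres⁻ X) (pres⁻ Y)))
        (submodular _ _ (⊆-image⁻¹ f X⊆fS) (⊆-image⁻¹ f Y⊆fS))
    ; two = λ e e∈fS → subst (_≤ 2) (sym (trans (pres⁻ ⁅ e ⁆) (cong ρ (image-⁅⁆ (↔-sym f) e))))
        (two (from f e) (∈-image⁻ f e∈fS))
    }
    where
    open Is2Polymatroid poly
    pres⁻ : RankPreserving (↔-sym f) σ ρ
    pres⁻ = rankPreserving-sym f pres

contract-image : (f : Fin n ↔ Fin m) {ρ : SetFn n} {σ : SetFn m} → RankPreserving f ρ σ →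
  (Y : Subset n) → RankPreserving f (contract Y ρ) (contract (image f Y) σ)
contract-image f {σ = σ} pres Y Z =
  cong₂ _∸_ (trans (pres (Z ∪ Y)) (cong σ (image-∪ f Z Y))) (pres Y)

module _ (lookup-levelⁿ : LookupLevel n) (lookup-levelᵐ : LookupLevel m) where

  inClass-image : (f : Fin n ↔ Fin m) {ρ : SetFn n} {σ : SetFn m} → RankPreserving f ρ σ →
    {S : Subset n} → InClass S ρ → InClass (image f S) σ
  inClass-image f {σ = σ} pres (poly , binary) =
    is2Polymatroid-image f {σ = σ} pres poly , binary-image lookup-levelⁿ lookup-levelᵐ f pres binary

excludedMinor-iso : LookupLevel n → LookupLevel m → {ρ : SetFn n} {σ : SetFn m} →
  Isomorphic ρ σ → ExcludedMinor ρ → ExcludedMinor σ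
excludedMinor-iso lookup-levelⁿ lookup-levelᵐ {ρ} {σ} (f , pres) (poly , notInClass , minorsInClass) =
  subst (λ S → Is2Polymatroid S σ) (image-replicate f true) (is2Polymatroid-image f {σ = σ} pres poly) ,
  (λ inClass → notInClass (subst (λ S → InClass S ρ) (image-replicate (↔-sym f) true)
    (inClass-image lookup-levelᵐ lookup-levelⁿ (↔-sym f) (rankPreserving-sym f pres) inClass))) ,
  λ X Y disjoint nonempty → subst₂ InClass (complement X Y) (cong (λ Y → contract Y σ) (image-inverse′ f Y))
    (inClass-image lookup-levelⁿ lookup-levelᵐ f (contract-image f {σ = σ} pres (image f⁻¹ Y))
      (minorsInClass (image f⁻¹ X) (image f⁻¹ Y)
        (λ e e∈X e∈Y → disjoint (to f e) (∈-image⁻ f⁻¹ e∈X) (∈-image⁻ f⁻¹ e∈Y))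
        (subst Nonempty (image-∪ f⁻¹ X Y) (image-nonempty f⁻¹ nonempty))))
  where
  f⁻¹ = ↔-sym f
  complement : ∀ X Y → image f (∁ (image f⁻¹ X ∪ image f⁻¹ Y)) ≡ ∁ (X ∪ Y)
  complement X Y = trans (image-∁ f (image f⁻¹ X ∪ image f⁻¹ Y)) (cong ∁
    (trans (image-∪ f (image f⁻¹ X) (image f⁻¹ Y)) (cong₂ _∪_ (image-inverse′ f X) (image-inverse′ f Y))))

isomorphic-trans : {ρ : SetFn n} {σ : SetFn m} {τ : SetFn k} → Isomorphic ρ σ → Isomorphic σ τ → Isomorphic ρ τ
isomorphic-trans {τ = τ} (f , ρ≅σ) (g , σ≅τ) =
  ↔-trans f g , λ Y → trans (ρ≅σ Y) (trans (σ≅τ (image f Y)) (cong τ (sym (image-↔-trans f g Y))))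

≗⇒isomorphic : {ρ σ : SetFn n} → (∀ Y → ρ Y ≡ σ Y) → Isomorphic ρ σ
≗⇒isomorphic {σ = σ} ρ≗σ = ↔-refl , λ Y → trans (ρ≗σ Y) (cong σ (sym (image-↔-refl Y)))

isomorphic-relabel : (ρ : SetFn n) (f : Fin m ↔ Fin n) → Isomorphic ρ (ρ ∘ image f)
isomorphic-relabel ρ f = ↔-sym f , λ Y → cong ρ (sym (image-inverse′ f Y))

-- Circuits of binary natural matroids

_∆_ : NSet n → NSet n → NSet n
(X₀ , X₁) ∆ (Y₀ , Y₁) = zipWith _xor_ X₀ Y₀ , zipWith _xor_ X₁ Y₁

nsum-∆ : (v : Vectors k n) (X Y : NSet n) → nsum v (X ∆ Y) ≡ nsum v X ⊕ nsum v Y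
nsum-∆ {k} v (X₀ , X₁) (Y₀ , Y₁) =
  trans (cong₂ _⊕_ (sumSub-xor (v zero) X₀ Y₀) (sumSub-xor (v (suc zero)) X₁ Y₁))
        (interchange (CommutativeMonoid.commutativeSemigroup (⊕-commutativeMonoid k)) _ _ _ _)

⊆ₙ-refl : (X : NSet n) → X ⊆ₙ X
⊆ₙ-refl X = (λ x → x) , (λ x → x)

inGround-⊆ : {S : Subset n} {ρ : SetFn n} {Z X : NSet n} → Z ⊆ₙ X → InGround S ρ X → InGround S ρ Z
inGround-⊆ {Z = _ , _} {_ , _} (Z₀⊆X₀ , Z₁⊆X₁) (X₀⊆ , X₁⊆) = X₀⊆ ∘ Z₀⊆X₀ , X₁⊆ ∘ Z₁⊆X₁

IsCircuit : Subset n → SetFn n → NSet n → Set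
IsCircuit S ρ C = InGround S ρ C × ¬ NatIndep S ρ C × (∀ Z → Z ⊆ₙ C → Z ≢ C → NatIndep S ρ Z)

≡-decᵥ : DecidableEquality (Vec Bool k)
≡-decᵥ = Vec.≡-dec Bool._≟_

≡-decₙ : DecidableEquality (NSet n)
≡-decₙ = Product.≡-dec ≡-decᵥ ≡-decᵥ

representation-circuit-sum : {S : Subset n} {ρ : SetFn n} {v : Vectors k n} → Represents S ρ v →
  {C : NSet n} → IsCircuit S ρ C → nsum v C ≡ zeroV
representation-circuit-sum {S = S} {ρ} {v} represents {C} (ground , dependent , proper) with ≡-decᵥ (nsum v C) zeroV
... | yes sum≡0 = sum≡0
... | no sum≢0 = contradiction (proj₂ (represents C ground) independent) dependent
  where
  independent : GF2Indep v C
  independent Z Z⊆C nonempty sum≡0 with ≡-decₙ Z C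
  ... | yes refl = sum≢0 sum≡0
  ... | no Z≢C = proj₁ (represents Z (inGround-⊆ {S = S} {ρ} Z⊆C ground)) (proper Z Z⊆C Z≢C) Z (⊆ₙ-refl Z) nonempty sum≡0

binary⇒circuit-∆-dependent : {S : Subset n} {ρ : SetFn n} → NaturalMatroidBinary S ρ →
  {C₁ C₂ : NSet n} → IsCircuit S ρ C₁ → IsCircuit S ρ C₂ →
  InGround S ρ (C₁ ∆ C₂) → NNonempty (C₁ ∆ C₂) → ¬ NatIndep S ρ (C₁ ∆ C₂)
binary⇒circuit-∆-dependent {S = S} {ρ} (k , v , represents) {C₁} {C₂} circuit₁ circuit₂ ground nonempty independent =
  proj₁ (represents (C₁ ∆ C₂) ground) independent (C₁ ∆ C₂) (⊆ₙ-refl _) nonempty (begin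
    nsum v (C₁ ∆ C₂)        ≡⟨ nsum-∆ v C₁ C₂ ⟩
    nsum v C₁ ⊕ nsum v C₂   ≡⟨ cong₂ _⊕_ (representation-circuit-sum {S = S} {ρ} {v} represents circuit₁)
                                         (representation-circuit-sum {S = S} {ρ} {v} represents circuit₂) ⟩
    zeroV ⊕ zeroV           ≡⟨ ⊕-self zeroV ⟩
    zeroV                   ∎)
  where open ≡-Reasoning

BinaryObstruction : Subset n → SetFn n → NSet n → NSet n → Set
BinaryObstruction S ρ C₁ C₂ = IsCircuit S ρ C₁ × IsCircuit S ρ C₂ ×
  InGround S ρ (C₁ ∆ C₂) × NNonempty (C₁ ∆ C₂) × NatIndep S ρ (C₁ ∆ C₂)

obstruction⇒¬binary : {S : Subset n} {ρ : SetFn n} {C₁ C₂ : NSet n} →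
  BinaryObstruction S ρ C₁ C₂ → ¬ NaturalMatroidBinary S ρ
obstruction⇒¬binary (circuit₁ , circuit₂ , ground , nonempty , independent) binary =
  binary⇒circuit-∆-dependent binary circuit₁ circuit₂ ground nonempty independent

allSubset? : {P : Subset n → Set} → (∀ Z → Dec (P Z)) → Dec (∀ Z → P Z)
allSubset? {zero}  P? = map′ (λ p → λ { [] → p }) (λ p → p []) (P? [])
allSubset? {suc n} P? = map′
  (λ (p , q) → λ { (true ∷ Z) → p Z ; (false ∷ Z) → q Z })
  (λ p → (λ Z → p (true ∷ Z)) , (λ Z → p (false ∷ Z)))
  (allSubset? (P? ∘ (true ∷_)) ×-dec allSubset? (P? ∘ (false ∷_)))

allNSet? : {P : NSet n → Set} → (∀ Z → Dec (P Z)) → Dec (∀ Z → P Z)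
allNSet? P? = map′ (λ p (Z₀ , Z₁) → p Z₀ Z₁) (λ p Z₀ Z₁ → p (Z₀ , Z₁))
  (allSubset? λ Z₀ → allSubset? λ Z₁ → P? (Z₀ , Z₁))

⊆ₙ? : (Z X : NSet n) → Dec (Z ⊆ₙ X)
⊆ₙ? (Z₀ , Z₁) (X₀ , X₁) = (Z₀ ⊆? X₀) ×-dec (Z₁ ⊆? X₁)

nnonempty? : (Z : NSet n) → Dec (NNonempty Z)
nnonempty? (Z₀ , Z₁) = nonempty? Z₀ ⊎-dec nonempty? Z₁

module _ (S : Subset n) (ρ : SetFn n) where

  inGround? : (X : NSet n) → Dec (InGround S ρ X)
  inGround? (X₀ , X₁) = (X₀ ⊆? level S ρ 1) ×-dec (X₁ ⊆? level S ρ 2)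

  natRankIs? : (X : NSet n) (r : ℕ) → Dec (NatRankIs S ρ X r)
  natRankIs? X r =
    anySubset? (λ A → (A ⊆? S) ×-dec (natVal S ρ X A ≟ r)) ×-dec
    allSubset? (λ A → (A ⊆? S) →-dec (r ≤? natVal S ρ X A))

  natIndep? : (X : NSet n) → Dec (NatIndep S ρ X)
  natIndep? X = natRankIs? X (ncard X)

  gf2Indep? : (v : Vectors k n) (X : NSet n) → Dec (GF2Indep v X)
  gf2Indep? v X = allNSet? λ Z → ⊆ₙ? Z X →-dec (nnonempty? Z →-dec ¬? (≡-decᵥ (nsum v Z) zeroV))

  represents? : (v : Vectors k n) → Dec (Represents S ρ v)
  represents? v = allNSet? λ X → inGround? X →-dec
    ((natIndep? X →-dec gf2Indep? v X) ×-dec (gf2Indep? v X →-dec natIndep? X))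

  isCircuit? : (C : NSet n) → Dec (IsCircuit S ρ C)
  isCircuit? C = inGround? C ×-dec ¬? (natIndep? C) ×-dec
    allNSet? (λ Z → ⊆ₙ? Z C →-dec (¬? (≡-decₙ Z C) →-dec natIndep? Z))

Submodular : SetFn n → Set
Submodular ρ = ∀ X Y → ρ (X ∪ Y) + ρ (X ∩ Y) ≤ ρ X + ρ Y

submodular? : (ρ : SetFn n) → Dec (Submodular ρ)
submodular? ρ = allSubset? λ X → allSubset? λ Y → ρ (X ∪ Y) + ρ (X ∩ Y) ≤? ρ X + ρ Y

disjoint? : (X Y : Subset n) → Dec (Disjoint X Y)
disjoint? X Y = all? λ e → (e ∈? X) →-dec ¬? (e ∈? Y)

data Certificate (n t : ℕ) : Set where
  not-submodular  : Certificate n t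
  representation  : (k : ℕ) → Vectors k n → Certificate n t
  nonbinary-minor : (X Y : Subset n) (C₁ C₂ : NSet n) → Certificate n t
  isomorphism     : Fin n ↔ Fin t → Certificate n t

Certifies : SetFn n → SetFn t → Certificate n t → Set
Certifies ρ τ not-submodular = ¬ Submodular ρ
Certifies ρ τ (representation k v) = Represents ⊤ ρ v
Certifies ρ τ (nonbinary-minor X Y C₁ C₂) =
  Disjoint X Y × Nonempty (X ∪ Y) × BinaryObstruction (∁ (X ∪ Y)) (contract Y ρ) C₁ C₂
Certifies ρ τ (isomorphism f) = RankPreserving f ρ τ

certifies? : (ρ : SetFn n) (τ : SetFn t) (c : Certificate n t) → Dec (Certifies ρ τ c)
certifies? ρ τ not-submodular = ¬? (submodular? ρ)
certifies? ρ τ (representation k v) = represents? ⊤ ρ v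
certifies? ρ τ (nonbinary-minor X Y C₁ C₂) =
  disjoint? X Y ×-dec nonempty? (X ∪ Y) ×-dec
  isCircuit? S σ C₁ ×-dec isCircuit? S σ C₂ ×-dec
  inGround? S σ (C₁ ∆ C₂) ×-dec nnonempty? (C₁ ∆ C₂) ×-dec natIndep? S σ (C₁ ∆ C₂)
  where
  S = ∁ (X ∪ Y)
  σ = contract Y ρ
certifies? ρ τ (isomorphism f) = allSubset? λ Y → ρ Y ≟ τ (image f Y)

excludedMinor-certified : {ρ : SetFn n} {τ : SetFn t} → ExcludedMinor ρ →
  (c : Certificate n t) → Certifies ρ τ c → Isomorphic ρ τ
excludedMinor-certified (poly , _) not-submodular ¬submodular =
  ⊥-elim (¬submodular λ X Y → Is2Polymatroid.submodular poly X Y (⊆-max X) (⊆-max Y))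
excludedMinor-certified (poly , notInClass , _) (representation k v) represents =
  ⊥-elim (notInClass (poly , k , v , represents))
excludedMinor-certified (_ , _ , minorsInClass) (nonbinary-minor X Y C₁ C₂) (disjoint , nonempty , obstruction) =
  ⊥-elim (obstruction⇒¬binary obstruction (proj₂ (minorsInClass X Y disjoint nonempty)))
excludedMinor-certified _ (isomorphism f) pres = f , pres

module _ {ρ : SetFn n} (poly : Is2Polymatroid ⊤ ρ) where

  rank-mono : ∀ {X Y} → X ⊆ Y → ρ X ≤ ρ Y
  rank-mono {X} {Y} = Is2Polymatroid.nondecreasing poly X Y (⊆-max Y)

  rank-subadditive : ∀ X Y → ρ (X ∪ Y) ≤ ρ X + ρ Y
  rank-subadditive X Y = m+n≤o⇒m≤o _ (Is2Polymatroid.submodular poly X Y (⊆-max X) (⊆-max Y))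

  rank-≥ : ∀ {X Y r} → X ⊆ Y → ρ X ≡ r → r ≤ ρ Y
  rank-≥ X⊆Y ρX≡r = subst (_≤ _) ρX≡r (rank-mono X⊆Y)

  rank-≤ : ∀ {r} X → ρ ⊤ ≡ r → ρ X ≤ r
  rank-≤ X ρ⊤≡r = subst (ρ X ≤_) ρ⊤≡r (rank-mono (⊆-max X))

≤-offset : ∀ {a u} k → a ≤ u → u ≤ a + k → Σ (Fin (suc k)) λ i → u ≡ a + toℕ i
≤-offset {zero}  {u}     k _ u≤k = fromℕ< (s≤s u≤k) , sym (toℕ-fromℕ< (s≤s u≤k))
≤-offset {suc a} {suc u} k (s≤s a≤u) (s≤s u≤a+k) with ≤-offset k a≤u u≤a+k
... | i , u≡a+i = i , cong suc u≡a+i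

point-off-line-rank : {ρ : SetFn n} → Is2Polymatroid ⊤ ρ → ∀ {p ℓ} →
  IsPoint ρ p → IsLine ρ ℓ → ¬ LiesOn ρ p ℓ → ρ (⁅ p ⁆ ∪ ⁅ ℓ ⁆) ≡ 3
point-off-line-rank {ρ = ρ} poly {p} {ℓ} point line notOnLine
  with ≤-offset 1 (rank-≥ poly (q⊆p∪q ⁅ p ⁆ ⁅ ℓ ⁆) line)
                  (subst₂ (λ r s → ρ (⁅ p ⁆ ∪ ⁅ ℓ ⁆) ≤ r + s) point line (rank-subadditive poly ⁅ p ⁆ ⁅ ℓ ⁆))
... | zero , onLine = contradiction onLine notOnLine
... | suc zero , ρ≡3 = ρ≡3

classify-by-certificate : LookupLevel n → {ρ σ : SetFn n} {τ : SetFn t} → ExcludedMinor ρ →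
  (∀ Y → ρ Y ≡ σ Y) → (c : Certificate n t) → Certifies σ τ c → Isomorphic ρ τ
classify-by-certificate lookup-level {τ = τ} excluded ρ≗σ c certified = isomorphic-trans {τ = τ} ρ≅σ
  (excludedMinor-certified {τ = τ} (excludedMinor-iso lookup-level lookup-level ρ≅σ excluded) c certified)
  where ρ≅σ = ≗⇒isomorphic ρ≗σ

vectors : Vec (Vec Bool k) n → Vec (Vec Bool k) n → Vectors k n
vectors first second zero = lookup first
vectors first second (suc zero) = lookup second

-- Three lines

module ThreeLinesCase where

  a b c : Fin 3
  a = zero
  b = suc zero
  c = suc (suc zero)

  candidate : ℕ → ℕ → ℕ → SetFn 3
  candidate ab ac bc (false ∷ false ∷ false ∷ []) = 0
  candidate ab ac bc (true  ∷ false ∷ false ∷ []) = 2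
  candidate ab ac bc (false ∷ true  ∷ false ∷ []) = 2
  candidate ab ac bc (false ∷ false ∷ true  ∷ []) = 2
  candidate ab ac bc (true  ∷ true  ∷ false ∷ []) = ab
  candidate ab ac bc (true  ∷ false ∷ true  ∷ []) = ac
  candidate ab ac bc (false ∷ true  ∷ true  ∷ []) = bc
  candidate ab ac bc (true  ∷ true  ∷ true  ∷ []) = 4

  certificate : ℕ → ℕ → ℕ → Certificate 3 3
  certificate 3 3 3 = representation 4 (vectors
    ((true ∷ false ∷ false ∷ false ∷ []) ∷ (false ∷ false ∷ true ∷ false ∷ []) ∷ (false ∷ false ∷ false ∷ true ∷ []) ∷ [])
    ((false ∷ true ∷ false ∷ false ∷ []) ∷ (true ∷ true ∷ true ∷ false ∷ []) ∷ (true ∷ true ∷ false ∷ true ∷ []) ∷ []))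
  certificate 3 3 4 = isomorphism ↔-refl
  certificate 3 4 3 = isomorphism (transpose a b)
  certificate 4 3 3 = isomorphism (transpose a c)
  -- A line spanning rank 4 with each of the other two turns them into one and
  -- the same line once it is contracted; two equal lines give U₂,₄.
  certificate _ 4 4 = nonbinary-minor ⊥ ⁅ c ⁆ (⁅ a ⁆ ∪ ⁅ b ⁆ , ⁅ a ⁆) (⁅ a ⁆ , ⁅ a ⁆ ∪ ⁅ b ⁆)
  certificate 4 _ 4 = nonbinary-minor ⊥ ⁅ b ⁆ (⁅ a ⁆ ∪ ⁅ c ⁆ , ⁅ a ⁆) (⁅ a ⁆ , ⁅ a ⁆ ∪ ⁅ c ⁆)
  certificate 4 4 _ = nonbinary-minor ⊥ ⁅ a ⁆ (⁅ b ⁆ ∪ ⁅ c ⁆ , ⁅ b ⁆) (⁅ b ⁆ , ⁅ b ⁆ ∪ ⁅ c ⁆)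
  certificate _ _ _ = not-submodular

  certified : ∀ (i j k : Fin 3) →
    let ab = 2 + toℕ i ; ac = 2 + toℕ j ; bc = 2 + toℕ k
    in Certifies (candidate ab ac bc) A₄ (certificate ab ac bc)
  certified = toWitness {a? = all? λ i → all? λ j → all? λ k →
    let ab = 2 + toℕ i ; ac = 2 + toℕ j ; bc = 2 + toℕ k
    in certifies? (candidate ab ac bc) A₄ (certificate ab ac bc)} tt

  classification : (ρ : SetFn 3) → ExcludedMinor ρ → ρ ⊤ ≡ 4 → (∀ e → IsLine ρ e) → Isomorphic ρ A₄
  classification ρ excluded ρ⊤≡4 line =
    classify-by-certificate lookup-level₃ excluded ρ≗ _ (certified (proj₁ ab) (proj₁ ac) (proj₁ bc))
    where
    poly = proj₁ excluded
    pair-offset : ∀ x y → Σ (Fin 3) λ i → ρ (⁅ x ⁆ ∪ ⁅ y ⁆) ≡ 2 + toℕ i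
    pair-offset x y = ≤-offset 2 (rank-≥ poly (p⊆p∪q ⁅ y ⁆) (line x)) (rank-≤ poly (⁅ x ⁆ ∪ ⁅ y ⁆) ρ⊤≡4)
    ab = pair-offset a b
    ac = pair-offset a c
    bc = pair-offset b c

    ρ≗ : ∀ Y → ρ Y ≡ candidate (2 + toℕ (proj₁ ab)) (2 + toℕ (proj₁ ac)) (2 + toℕ (proj₁ bc)) Y
    ρ≗ (false ∷ false ∷ false ∷ []) = Is2Polymatroid.normalized poly
    ρ≗ (true  ∷ false ∷ false ∷ []) = line a
    ρ≗ (false ∷ true  ∷ false ∷ []) = line b
    ρ≗ (false ∷ false ∷ true  ∷ []) = line c
    ρ≗ (true  ∷ true  ∷ false ∷ []) = proj₂ ab
    ρ≗ (true  ∷ false ∷ true  ∷ []) = proj₂ ac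
    ρ≗ (false ∷ true  ∷ true  ∷ []) = proj₂ bc
    ρ≗ (true  ∷ true  ∷ true  ∷ []) = ρ⊤≡4

threeLines-classification : (n : ℕ) (ρ : SetFn n) → ExcludedMinor ρ → ρ ⊤ ≡ 4 → ThreeLines ρ → Isomorphic ρ A₄
threeLines-classification .3 ρ excluded ρ⊤≡4 (refl , line) = ThreeLinesCase.classification ρ excluded ρ⊤≡4 line

-- Two lines and two points

NoPointOnLine : SetFn n → Set
NoPointOnLine ρ = ∀ p ℓ → IsPoint ρ p → IsLine ρ ℓ → ¬ LiesOn ρ p ℓ

module TwoLinesTwoPointsCase where

  a₁ a₂ b c : Fin 4
  a₁ = zero
  a₂ = suc zero
  b = suc (suc zero)
  c = suc (suc (suc zero))

  candidate : ℕ → ℕ → ℕ → ℕ → ℕ → ℕ → SetFn 4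
  candidate a₁a₂ bc a₁a₂b a₁a₂c a₁bc a₂bc (false ∷ false ∷ false ∷ false ∷ []) = 0
  candidate a₁a₂ bc a₁a₂b a₁a₂c a₁bc a₂bc (true  ∷ false ∷ false ∷ false ∷ []) = 1
  candidate a₁a₂ bc a₁a₂b a₁a₂c a₁bc a₂bc (false ∷ true  ∷ false ∷ false ∷ []) = 1
  candidate a₁a₂ bc a₁a₂b a₁a₂c a₁bc a₂bc (false ∷ false ∷ true  ∷ false ∷ []) = 2
  candidate a₁a₂ bc a₁a₂b a₁a₂c a₁bc a₂bc (false ∷ false ∷ false ∷ true  ∷ []) = 2
  candidate a₁a₂ bc a₁a₂b a₁a₂c a₁bc a₂bc (true  ∷ true  ∷ false ∷ false ∷ []) = a₁a₂
  candidate a₁a₂ bc a₁a₂b a₁a₂c a₁bc a₂bc (true  ∷ false ∷ true  ∷ false ∷ []) = 3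
  candidate a₁a₂ bc a₁a₂b a₁a₂c a₁bc a₂bc (false ∷ true  ∷ true  ∷ false ∷ []) = 3
  candidate a₁a₂ bc a₁a₂b a₁a₂c a₁bc a₂bc (true  ∷ false ∷ false ∷ true  ∷ []) = 3
  candidate a₁a₂ bc a₁a₂b a₁a₂c a₁bc a₂bc (false ∷ true  ∷ false ∷ true  ∷ []) = 3
  candidate a₁a₂ bc a₁a₂b a₁a₂c a₁bc a₂bc (false ∷ false ∷ true  ∷ true  ∷ []) = bc
  candidate a₁a₂ bc a₁a₂b a₁a₂c a₁bc a₂bc (true  ∷ true  ∷ true  ∷ false ∷ []) = a₁a₂b
  candidate a₁a₂ bc a₁a₂b a₁a₂c a₁bc a₂bc (true  ∷ true  ∷ false ∷ true  ∷ []) = a₁a₂c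
  candidate a₁a₂ bc a₁a₂b a₁a₂c a₁bc a₂bc (true  ∷ false ∷ true  ∷ true  ∷ []) = a₁bc
  candidate a₁a₂ bc a₁a₂b a₁a₂c a₁bc a₂bc (false ∷ true  ∷ true  ∷ true  ∷ []) = a₂bc
  candidate a₁a₂ bc a₁a₂b a₁a₂c a₁bc a₂bc (true  ∷ true  ∷ true  ∷ true  ∷ []) = 4

  lines-parallel-over-points : Certificate 4 4
  lines-parallel-over-points =
    nonbinary-minor ⊥ (⁅ a₁ ⁆ ∪ ⁅ a₂ ⁆) (⁅ b ⁆ ∪ ⁅ c ⁆ , ⁅ b ⁆) (⁅ b ⁆ , ⁅ b ⁆ ∪ ⁅ c ⁆)

  certificate : ℕ → ℕ → ℕ → ℕ → ℕ → ℕ → Certificate 4 4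
  certificate 1 3 3 3 4 4 = representation 4 (vectors
    ((true ∷ false ∷ false ∷ false ∷ []) ∷ (true ∷ false ∷ false ∷ false ∷ []) ∷
     (false ∷ true ∷ false ∷ false ∷ []) ∷ (false ∷ false ∷ false ∷ true ∷ []) ∷ [])
    ((false ∷ false ∷ false ∷ false ∷ []) ∷ (false ∷ false ∷ false ∷ false ∷ []) ∷
     (false ∷ false ∷ true ∷ false ∷ []) ∷ (false ∷ true ∷ true ∷ true ∷ []) ∷ []))
  certificate 1 4 3 3 4 4 = representation 4 (vectors
    ((true ∷ false ∷ false ∷ false ∷ []) ∷ (true ∷ false ∷ false ∷ false ∷ []) ∷
     (false ∷ true ∷ false ∷ false ∷ []) ∷ (false ∷ false ∷ false ∷ true ∷ []) ∷ [])
    ((false ∷ false ∷ false ∷ false ∷ []) ∷ (false ∷ false ∷ false ∷ false ∷ []) ∷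
     (false ∷ false ∷ true ∷ false ∷ []) ∷ (true ∷ true ∷ true ∷ true ∷ []) ∷ []))
  certificate 2 3 3 3 4 4 = representation 4 (vectors
    ((true ∷ false ∷ false ∷ false ∷ []) ∷ (false ∷ true ∷ false ∷ false ∷ []) ∷
     (false ∷ false ∷ true ∷ false ∷ []) ∷ (false ∷ false ∷ false ∷ true ∷ []) ∷ [])
    ((false ∷ false ∷ false ∷ false ∷ []) ∷ (false ∷ false ∷ false ∷ false ∷ []) ∷
     (true ∷ true ∷ true ∷ false ∷ []) ∷ (true ∷ true ∷ false ∷ true ∷ []) ∷ []))
  certificate 2 4 3 3 4 4 = isomorphism ↔-refl
  certificate 2 3 3 4 4 4 = nonbinary-minor ⊥ ⁅ a₁ ⁆
    (⁅ a₂ ⁆ ∪ ⁅ b ⁆ , ⁅ b ⁆) (⁅ a₂ ⁆ ∪ ⁅ b ⁆ ∪ ⁅ c ⁆ , ⁅ c ⁆)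
  certificate 2 3 4 3 4 4 = nonbinary-minor ⊥ ⁅ a₁ ⁆
    (⁅ a₂ ⁆ ∪ ⁅ b ⁆ ∪ ⁅ c ⁆ , ⁅ b ⁆) (⁅ a₂ ⁆ ∪ ⁅ c ⁆ , ⁅ c ⁆)
  certificate 2 4 3 4 4 4 = nonbinary-minor ⊥ ⁅ c ⁆
    (⁅ a₁ ⁆ ∪ ⁅ a₂ ⁆ ∪ ⁅ b ⁆ , ⊥) (⁅ a₁ ⁆ ∪ ⁅ a₂ ⁆ , ⁅ b ⁆)
  certificate 2 4 4 3 4 4 = nonbinary-minor ⊥ ⁅ b ⁆
    (⁅ a₁ ⁆ ∪ ⁅ a₂ ⁆ ∪ ⁅ c ⁆ , ⊥) (⁅ a₁ ⁆ ∪ ⁅ a₂ ⁆ , ⁅ c ⁆)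
  certificate 2 _ 4 4 _ _ = lines-parallel-over-points
  certificate _ _ _ _ _ _ = not-submodular

  certified : ∀ (i : Fin 2) (j : Fin 3) (k₁ k₂ k₃ k₄ : Fin 2) →
    let a₁a₂ = 1 + toℕ i ; bc = 2 + toℕ j
        a₁a₂b = 3 + toℕ k₁ ; a₁a₂c = 3 + toℕ k₂ ; a₁bc = 3 + toℕ k₃ ; a₂bc = 3 + toℕ k₄
    in Certifies (candidate a₁a₂ bc a₁a₂b a₁a₂c a₁bc a₂bc) B₄ (certificate a₁a₂ bc a₁a₂b a₁a₂c a₁bc a₂bc)
  certified = toWitness {a? = all? λ i → all? λ j → all? λ k₁ → all? λ k₂ → all? λ k₃ → all? λ k₄ →
    let a₁a₂ = 1 + toℕ i ; bc = 2 + toℕ j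
        a₁a₂b = 3 + toℕ k₁ ; a₁a₂c = 3 + toℕ k₂ ; a₁bc = 3 + toℕ k₃ ; a₂bc = 3 + toℕ k₄
    in certifies? (candidate a₁a₂ bc a₁a₂b a₁a₂c a₁bc a₂bc) B₄ (certificate a₁a₂ bc a₁a₂b a₁a₂c a₁bc a₂bc)} tt

  classification : (ρ : SetFn 4) → ExcludedMinor ρ → ρ ⊤ ≡ 4 →
    IsPoint ρ a₁ → IsPoint ρ a₂ → IsLine ρ b → IsLine ρ c → NoPointOnLine ρ → Isomorphic ρ B₄
  classification ρ excluded ρ⊤≡4 point₁ point₂ line₁ line₂ noPointOnLine =
    classify-by-certificate lookup-level₄ excluded ρ≗ _
      (certified (proj₁ a₁a₂) (proj₁ bc) (proj₁ a₁a₂b) (proj₁ a₁a₂c) (proj₁ a₁bc) (proj₁ a₂bc))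
    where
    poly = proj₁ excluded
    point-line : ∀ p ℓ → IsPoint ρ p → IsLine ρ ℓ → ρ (⁅ p ⁆ ∪ ⁅ ℓ ⁆) ≡ 3
    point-line p ℓ point line = point-off-line-rank poly {p} {ℓ} point line (noPointOnLine p ℓ point line)
    triple-offset : ∀ X Y → ρ X ≡ 3 → True (X ⊆? Y) → Σ (Fin 2) λ i → ρ Y ≡ 3 + toℕ i
    triple-offset X Y ρX≡3 X⊆Y = ≤-offset 1 (rank-≥ poly (toWitness X⊆Y) ρX≡3) (rank-≤ poly Y ρ⊤≡4)

    a₁a₂ = ≤-offset 1 (rank-≥ poly (p⊆p∪q ⁅ a₂ ⁆) point₁)
      (subst₂ (λ r s → ρ (⁅ a₁ ⁆ ∪ ⁅ a₂ ⁆) ≤ r + s) point₁ point₂ (rank-subadditive poly ⁅ a₁ ⁆ ⁅ a₂ ⁆))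
    bc = ≤-offset 2 (rank-≥ poly (p⊆p∪q ⁅ c ⁆) line₁) (rank-≤ poly (⁅ b ⁆ ∪ ⁅ c ⁆) ρ⊤≡4)
    a₁a₂b = triple-offset (⁅ a₁ ⁆ ∪ ⁅ b ⁆) (⁅ a₁ ⁆ ∪ ⁅ a₂ ⁆ ∪ ⁅ b ⁆) (point-line a₁ b point₁ line₁) tt
    a₁a₂c = triple-offset (⁅ a₁ ⁆ ∪ ⁅ c ⁆) (⁅ a₁ ⁆ ∪ ⁅ a₂ ⁆ ∪ ⁅ c ⁆) (point-line a₁ c point₁ line₂) tt
    a₁bc = triple-offset (⁅ a₁ ⁆ ∪ ⁅ b ⁆) (⁅ a₁ ⁆ ∪ ⁅ b ⁆ ∪ ⁅ c ⁆) (point-line a₁ b point₁ line₁) tt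
    a₂bc = triple-offset (⁅ a₂ ⁆ ∪ ⁅ b ⁆) (⁅ a₂ ⁆ ∪ ⁅ b ⁆ ∪ ⁅ c ⁆) (point-line a₂ b point₂ line₁) tt

    ρ≗ : ∀ Y → ρ Y ≡ candidate (1 + toℕ (proj₁ a₁a₂)) (2 + toℕ (proj₁ bc))
      (3 + toℕ (proj₁ a₁a₂b)) (3 + toℕ (proj₁ a₁a₂c)) (3 + toℕ (proj₁ a₁bc)) (3 + toℕ (proj₁ a₂bc)) Y
    ρ≗ (false ∷ false ∷ false ∷ false ∷ []) = Is2Polymatroid.normalized poly
    ρ≗ (true  ∷ false ∷ false ∷ false ∷ []) = point₁
    ρ≗ (false ∷ true  ∷ false ∷ false ∷ []) = point₂
    ρ≗ (false ∷ false ∷ true  ∷ false ∷ []) = line₁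
    ρ≗ (false ∷ false ∷ false ∷ true  ∷ []) = line₂
    ρ≗ (true  ∷ true  ∷ false ∷ false ∷ []) = proj₂ a₁a₂
    ρ≗ (true  ∷ false ∷ true  ∷ false ∷ []) = point-line a₁ b point₁ line₁
    ρ≗ (false ∷ true  ∷ true  ∷ false ∷ []) = point-line a₂ b point₂ line₁
    ρ≗ (true  ∷ false ∷ false ∷ true  ∷ []) = point-line a₁ c point₁ line₂
    ρ≗ (false ∷ true  ∷ false ∷ true  ∷ []) = point-line a₂ c point₂ line₂
    ρ≗ (false ∷ false ∷ true  ∷ true  ∷ []) = proj₂ bc
    ρ≗ (true  ∷ true  ∷ true  ∷ false ∷ []) = proj₂ a₁a₂b
    ρ≗ (true  ∷ true  ∷ false ∷ true  ∷ []) = proj₂ a₁a₂c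
    ρ≗ (true  ∷ false ∷ true  ∷ true  ∷ []) = proj₂ a₁bc
    ρ≗ (false ∷ true  ∷ true  ∷ true  ∷ []) = proj₂ a₂bc
    ρ≗ (true  ∷ true  ∷ true  ∷ true  ∷ []) = ρ⊤≡4

open TwoLinesTwoPointsCase using (a₁; a₂; b; c)

point≢line : {ρ : SetFn n} {p ℓ : Fin n} → IsPoint ρ p → IsLine ρ ℓ → p ≢ ℓ
point≢line point line refl with trans (sym point) line
... | ()

noPointOnLine-relabel : {ρ : SetFn n} (f : Fin m ↔ Fin n) → NoPointOnLine ρ → NoPointOnLine (ρ ∘ image f)
noPointOnLine-relabel {ρ = ρ} f noPointOnLine p ℓ point line onLine =
  noPointOnLine (to f p) (to f ℓ) (trans (sym (singleton p)) point) (trans (sym (singleton ℓ)) line)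
    (trans (cong ρ (sym (trans (image-∪ f ⁅ p ⁆ ⁅ ℓ ⁆) (cong₂ _∪_ (image-⁅⁆ f p) (image-⁅⁆ f ℓ))))) onLine)
  where
  singleton : ∀ i → ρ (image f ⁅ i ⁆) ≡ ρ ⁅ to f i ⁆
  singleton i = cong ρ (image-⁅⁆ f i)

labelling : {ρ : SetFn n} → TwoLinesTwoPoints ρ → Σ (Fin 4 ↔ Fin n) λ h →
  IsPoint ρ (to h a₁) × IsPoint ρ (to h a₂) × IsLine ρ (to h b) × IsLine ρ (to h c)
labelling {n} {ρ} (x₁ , x₂ , y₁ , y₂ , x₁≢x₂ , y₁≢y₂ , point₁ , point₂ , line₁ , line₂ , cover) =
  ⤖⇒↔ (mk⤖ {to = label} (injective , surjective)) , point₁ , point₂ , line₁ , line₂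
  where
  label : Fin 4 → Fin n
  label zero = x₁
  label (suc zero) = x₂
  label (suc (suc zero)) = y₁
  label (suc (suc (suc zero))) = y₂

  x₁≢y₁ = point≢line {ρ = ρ} point₁ line₁
  x₁≢y₂ = point≢line {ρ = ρ} point₁ line₂
  x₂≢y₁ = point≢line {ρ = ρ} point₂ line₁
  x₂≢y₂ = point≢line {ρ = ρ} point₂ line₂

  injective : ∀ {i j} → label i ≡ label j → i ≡ j
  injective {zero}                 {zero}                 _  = refl
  injective {zero}                 {suc zero}             eq = contradiction eq x₁≢x₂
  injective {zero}                 {suc (suc zero)}       eq = contradiction eq x₁≢y₁
  injective {zero}                 {suc (suc (suc zero))} eq = contradiction eq x₁≢y₂
  injective {suc zero}             {zero}                 eq = contradiction (sym eq) x₁≢x₂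
  injective {suc zero}             {suc zero}             _  = refl
  injective {suc zero}             {suc (suc zero)}       eq = contradiction eq x₂≢y₁
  injective {suc zero}             {suc (suc (suc zero))} eq = contradiction eq x₂≢y₂
  injective {suc (suc zero)}       {zero}                 eq = contradiction (sym eq) x₁≢y₁
  injective {suc (suc zero)}       {suc zero}             eq = contradiction (sym eq) x₂≢y₁
  injective {suc (suc zero)}       {suc (suc zero)}       _  = refl
  injective {suc (suc zero)}       {suc (suc (suc zero))} eq = contradiction eq y₁≢y₂
  injective {suc (suc (suc zero))} {zero}                 eq = contradiction (sym eq) x₁≢y₂
  injective {suc (suc (suc zero))} {suc zero}             eq = contradiction (sym eq) x₂≢y₂
  injective {suc (suc (suc zero))} {suc (suc zero)}       eq = contradiction (sym eq) y₁≢y₂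
  injective {suc (suc (suc zero))} {suc (suc (suc zero))} _  = refl

  surjective : ∀ e → Σ (Fin 4) λ i → ∀ {j} → j ≡ i → label j ≡ e
  surjective e with cover e
  ... | inj₁ e≡x₁               = zero , λ { refl → sym e≡x₁ }
  ... | inj₂ (inj₁ e≡x₂)        = suc zero , λ { refl → sym e≡x₂ }
  ... | inj₂ (inj₂ (inj₁ e≡y₁)) = suc (suc zero) , λ { refl → sym e≡y₁ }
  ... | inj₂ (inj₂ (inj₂ e≡y₂)) = suc (suc (suc zero)) , λ { refl → sym e≡y₂ }

twoLinesTwoPoints-classification : (n : ℕ) (ρ : SetFn n) → ExcludedMinor ρ → ρ ⊤ ≡ 4 →
  TwoLinesTwoPoints ρ → NoPointOnLine ρ → Isomorphic ρ B₄
twoLinesTwoPoints-classification n ρ excluded ρ⊤≡4 shape noPointOnLine with labelling {ρ = ρ} shape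
... | h , point₁ , point₂ , line₁ , line₂ with ↔⇒≡ h
... | refl = isomorphic-trans {τ = B₄} ρ≅ρ′ (TwoLinesTwoPointsCase.classification ρ′
      (excludedMinor-iso lookup-level₄ lookup-level₄ ρ≅ρ′ excluded)
      (trans (cong ρ (image-replicate h true)) ρ⊤≡4)
      (relabelled a₁ point₁) (relabelled a₂ point₂) (relabelled b line₁) (relabelled c line₂)
      (noPointOnLine-relabel {ρ = ρ} h noPointOnLine))
  where
  ρ′ = ρ ∘ image h
  ρ≅ρ′ = isomorphic-relabel ρ h
  relabelled : ∀ i {r} → ρ ⁅ to h i ⁆ ≡ r → ρ′ ⁅ i ⁆ ≡ r
  relabelled i = trans (cong ρ (image-⁅⁆ h i))

lemma6p3 : (n : ℕ) (ρ : SetFn n) → ExcludedMinor ρ → ρ ⊤ ≡ 4 →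
    (ThreeLines ρ → Isomorphic ρ A₄) ×
    (TwoLinesTwoPoints ρ → (∀ p ℓ → IsPoint ρ p → IsLine ρ ℓ → ¬ LiesOn ρ p ℓ) →
    Isomorphic ρ B₄)
lemma6p3 n ρ excluded ρ⊤≡4 =
  threeLines-classification n ρ excluded ρ⊤≡4 , twoLinesTwoPoints-classification n ρ excluded ρ⊤≡4
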